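{- Let $G$ be a quasi-bipartite graph with terminal set $T$, $|T|=k$, such that for every $\emptyset\subsetneq S\subsetneq T$ there is a unique minimum cut in $G$ separating $S$ from $T\setminus S$. Then the number of distinct profiles $|\Pi(G)|$ of vertices of $G$ is $k^{O(k^2)}$.
   Context: Graphs are undirected with positive edge weights; a graph is quasi-bipartite if every edge is incident to a terminal. A minimum cut separating $S$ from $T\setminus S$ is a bipartition $(A,V(G)\setminus A)$ with $S\subseteq A$, $T\setminus S\subseteq V(G)\setminus A$, minimizing the total weight of edges between $A$ and $V(G)\setminus A$. The profile of a vertex $v$ is the $(2^{k}-2)$-dimensional $0/1$ vector $\pi^v$ indexed by the sets $\emptyset\subsetneq S\subsetneq T$, with $\pi^v_S=1$ iff $v$ lies on the $S$ side $A$ of the unique minimum cut separating $S$ from $T\setminus S$. $\Pi(G)=\{\pi^v\mid v\in V(G)\}$.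
   Formalization: The edge weights of G are positive rationals. -}

module Defs where

open import Data.Nat using (ℕ; zero; suc)
import Data.Nat
open import Data.Bool using (Bool; true; false; _∧_; not; if_then_else_)
open import Data.Fin using (Fin; zero; suc)
open import Data.Fin.Subset using (Subset; _∈_; _∉_; _⊆_; _⊂_; Nonempty; _─_)
open import Data.Vec using (lookup)
open import Data.Rational using (ℚ; 0ℚ; _+_; _≤_; _<_)
open import Data.Product using (_×_; ∃-syntax; Σ-syntax)
open import Data.Sum using (_⊎_)
open import Relation.Binary.PropositionalEquality using (_≡_)
open import Relation.Nullary using (¬_)
open import Function.Bundles using (_⇔_)

ΣF : {n : ℕ} → (Fin n → ℚ) → ℚ
ΣF {zero}  f = 0ℚ
ΣF {suc n} f = f zero + ΣF (λ i → f (suc i))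

-- An undirected graph on vertex set Fin n with positive edge weights,
-- encoded by a symmetric weight function: {u,v} is an edge iff 0 < w u v,
-- and then its weight is w u v.
record WGraph (n : ℕ) : Set where
  field
    w        : Fin n → Fin n → ℚ
    w-nonneg : ∀ u v → 0ℚ ≤ w u v
    w-sym    : ∀ u v → w u v ≡ w v u
    w-noloop : ∀ u → w u u ≡ 0ℚ
open WGraph public

IsEdge : {n : ℕ} → WGraph n → Fin n → Fin n → Set
IsEdge G u v = 0ℚ < w G u v

QuasiBipartite : {n : ℕ} → WGraph n → Subset n → Set
QuasiBipartite G T = ∀ u v → IsEdge G u v → u ∈ T ⊎ v ∈ T

cutWeight : {n : ℕ} → WGraph n → Subset n → ℚ
cutWeight G A =
  ΣF (λ u → ΣF (λ v → if lookup A u ∧ not (lookup A v) then w G u v else 0ℚ))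

ProperTermSubset : {n : ℕ} → Subset n → Subset n → Set
ProperTermSubset T S = Nonempty S × S ⊂ T

Separates : {n : ℕ} → Subset n → Subset n → Subset n → Set
Separates T S A = S ⊆ A × (∀ {x} → x ∈ (T ─ S) → x ∉ A)

IsMinCut : {n : ℕ} → WGraph n → Subset n → Subset n → Subset n → Set
IsMinCut G T S A =
  Separates T S A × (∀ B → Separates T S B → cutWeight G A ≤ cutWeight G B)

UniqueMinCuts : {n : ℕ} → WGraph n → Subset n → Set
UniqueMinCuts {n} G T =
  ∀ S → ProperTermSubset T S →
    Σ[ A ∈ Subset n ] (IsMinCut G T S A × (∀ B → IsMinCut G T S B → B ≡ A))

SameProfile : {n : ℕ} → WGraph n → Subset n → Fin n → Fin n → Set
SameProfile G T u v =
  ∀ S → ProperTermSubset T S → ∀ A → IsMinCut G T S A → (u ∈ A ⇔ v ∈ A)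

-- |Π(G)| ≤ B : any family of vertices with pairwise distinct profiles
-- has at most B members.
ProfileCountAtMost : {n : ℕ} → WGraph n → Subset n → ℕ → Set
ProfileCountAtMost {n} G T B =
  ∀ (m : ℕ) (f : Fin m → Fin n) →
    (∀ i j → ¬ (i ≡ j) → ¬ SameProfile G T (f i) (f j)) → m Data.Nat.≤ B

{-# OPTIONS --safe #-}
module Submission where

-- Give every vertex v the vector ω v ∈ ℚⁿ which is the indicator of v if v is a terminal and its
-- row of edge weights otherwise (then supported on T, by quasi-bipartiteness), and every S ⊆ T the
-- point x S which is +1 on S, −1 on T ∖ S and 0 off T. If a non-terminal were not strictly more
-- attached to its own side of the unique minimum cut, moving it across would give another minimum
-- cut; so v is on the S side iff 0 < ω v · x S, and profiles are sign patterns of linear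
-- functionals on the 2^k points x S of the k-dimensional space ℚ^T. Any k + 1 of these points are
-- linearly dependent, so no family of such sign patterns shatters k + 1 of them, and the
-- Sauer–Shelah lemma bounds the number of patterns by (2^k + 1)^k ≤ k^(2k²).

open import Defs
open import Data.Bool.Base using (Bool; true; false; if_then_else_; _∧_; _∨_; not; T)
import Data.Bool.Properties as Bool
open import Data.Fin.Base using (Fin; zero; suc)
open import Data.Fin.Properties using (_≟_; any?; suc-injective; 0≢1+n)
open import Data.Fin.Subset using (Subset; inside; outside; _∈_; _∉_; _⊆_; ∣_∣; Nonempty; ⊥)
  renaming (_-_ to _∖_)
open import Data.Fin.Subset.Properties
  using ( _∈?_; nonempty?; Empty-unique; ∣⊥∣≡0; p─⊥≡p; p─q⊆p; x∈p∧x∉q⇒x∈p─q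
        ; drop-there; drop-∷-⊆; ∣p∣≤∣x∷p∣; ∉⊥)
open import Data.List.Base as List using (List)
import Data.List.Properties as List
open import Data.List.Membership.Propositional using () renaming (_∈_ to _∈ˡ_)
open import Data.List.Membership.Propositional.Properties using (∈-map⁺; ∈-++⁺ˡ; ∈-++⁺ʳ)
open import Data.List.Relation.Unary.Any using (here; index)
open import Data.List.Relation.Unary.Any.Properties using (lookup-index)
open import Data.Nat.Base as ℕ using (ℕ; zero; suc)
import Data.Nat.Properties as ℕ
open import Data.Product using (∃; ∃-syntax; _×_; _,_; proj₁; proj₂)
open import Data.Rational.Base as ℚ using (ℚ; 0ℚ; 1ℚ)
import Data.Rational.Properties as ℚ
open import Data.Sum using (inj₁; inj₂; [_,_]′)
open import Data.Vec.Base using ([]; _∷_; here; there; lookup; tabulate; _[_]≔_)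
open import Data.Vec.Functional using (Vector; tail)
open import Data.Vec.Properties
  using (≡-dec; lookup∘tabulate; lookup∘update; lookup∘update′; []≔-lookup; []=⇒lookup; lookup⇒[]=)
open import Function.Base using (_∘_)
open import Function.Bundles using (module Equivalence; _⇔_; mk⇔)
open import Function.Construct.Composition using (_⇔-∘_)
open import Function.Construct.Symmetry using (⇔-sym)
open import Function.Definitions using (Injective)
open import Relation.Binary.Definitions using (DecidableEquality)
open import Relation.Binary.PropositionalEquality
open import Relation.Nullary using (¬_; Dec; does; isYes; yes; no)
open import Relation.Nullary.Decidable
  using (dec-false; toWitness; fromWitness; ¬?; _×-dec_; decidable-stable)
open import Relation.Nullary.Negation using (contradiction)

open Equivalence using (to; from)

x∉p∖x : ∀ {n} {x : Fin n} {p : Subset n} → x ∉ p ∖ x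
x∉p∖x {x = zero}  {_ ∷ p} ()
x∉p∖x {x = suc x} {_ ∷ p} (there x∈p∖x) = x∉p∖x x∈p∖x

x∈p⇒suc∣p∖x∣≡∣p∣ : ∀ {n} {x : Fin n} {p : Subset n} → x ∈ p → suc ∣ p ∖ x ∣ ≡ ∣ p ∣
x∈p⇒suc∣p∖x∣≡∣p∣ {p = inside ∷ p}  here        = cong (suc ∘ ∣_∣) (p─⊥≡p p)
x∈p⇒suc∣p∖x∣≡∣p∣ {p = inside ∷ p}  (there x∈p) = cong suc (x∈p⇒suc∣p∖x∣≡∣p∣ x∈p)
x∈p⇒suc∣p∖x∣≡∣p∣ {p = outside ∷ p} (there x∈p) = x∈p⇒suc∣p∖x∣≡∣p∣ x∈p

0<∣p∣⇒Nonempty : ∀ {n} (p : Subset n) → 0 ℕ.< ∣ p ∣ → Nonempty p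
0<∣p∣⇒Nonempty {n} p 0<∣p∣ with nonempty? p
... | yes nonempty = nonempty
... | no  empty    =
  contradiction (trans (cong ∣_∣ (Empty-unique empty)) (∣⊥∣≡0 n)) (ℕ.>⇒≢ 0<∣p∣)

lookup-∉ : ∀ {n} {x : Fin n} {p : Subset n} → x ∉ p → lookup p x ≡ outside
lookup-∉ {x = x} {p} x∉p with lookup p x in eq
... | inside  = contradiction (lookup⇒[]= x p eq) x∉p
... | outside = refl

∈-update⁻ : ∀ {n} {x v : Fin n} {A : Subset n} {s} → x ≢ v → x ∈ A [ v ]≔ s → x ∈ A
∈-update⁻ {x = x} {A = A} x≢v x∈A′ =
  lookup⇒[]= x A (trans (sym (lookup∘update′ x≢v A _)) ([]=⇒lookup x∈A′))

∈-update⁺ : ∀ {n} {x v : Fin n} {A : Subset n} {s} → x ≢ v → x ∈ A → x ∈ A [ v ]≔ s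
∈-update⁺ {x = x} {A = A} x≢v x∈A =
  lookup⇒[]= x _ (trans (lookup∘update′ x≢v A _) ([]=⇒lookup x∈A))

subsetsOf : ∀ {n} → Subset n → List (Subset n)
subsetsOf []            = List.[ [] ]
subsetsOf (outside ∷ T) = List.map (outside ∷_) (subsetsOf T)
subsetsOf (inside ∷ T)  = List.map (outside ∷_) (subsetsOf T) List.++ List.map (inside ∷_) (subsetsOf T)

length-subsetsOf : ∀ {n} (T : Subset n) → List.length (subsetsOf T) ≡ 2 ℕ.^ ∣ T ∣
length-subsetsOf []            = refl
length-subsetsOf (outside ∷ T) = trans (List.length-map (outside ∷_) (subsetsOf T)) (length-subsetsOf T)
length-subsetsOf (inside ∷ T)  = begin
  List.length (List.map (outside ∷_) (subsetsOf T) List.++ List.map (inside ∷_) (subsetsOf T))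
    ≡⟨ List.length-++ (List.map (outside ∷_) (subsetsOf T)) ⟩
  List.length (List.map (outside ∷_) (subsetsOf T)) ℕ.+ List.length (List.map (inside ∷_) (subsetsOf T))
    ≡⟨ cong₂ ℕ._+_ (List.length-map (outside ∷_) (subsetsOf T))
                   (List.length-map (inside ∷_) (subsetsOf T)) ⟩
  List.length (subsetsOf T) ℕ.+ List.length (subsetsOf T)
    ≡⟨ cong (λ x → x ℕ.+ x) (length-subsetsOf T) ⟩
  2 ℕ.^ ∣ T ∣ ℕ.+ 2 ℕ.^ ∣ T ∣
    ≡⟨ cong (2 ℕ.^ ∣ T ∣ ℕ.+_) (ℕ.+-identityʳ _) ⟨
  2 ℕ.^ suc ∣ T ∣ ∎
  where open ≡-Reasoning

⊆⇒∈subsetsOf : ∀ {n} {S T : Subset n} → S ⊆ T → S ∈ˡ subsetsOf T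
⊆⇒∈subsetsOf {S = []}          {[]}          _   = here refl
⊆⇒∈subsetsOf {S = outside ∷ S} {outside ∷ T} S⊆T =
  ∈-map⁺ (outside ∷_) (⊆⇒∈subsetsOf (drop-∷-⊆ S⊆T))
⊆⇒∈subsetsOf {S = inside ∷ S}  {outside ∷ T} S⊆T = contradiction (S⊆T here) λ ()
⊆⇒∈subsetsOf {S = outside ∷ S} {inside ∷ T}  S⊆T =
  ∈-++⁺ˡ (∈-map⁺ (outside ∷_) (⊆⇒∈subsetsOf (drop-∷-⊆ S⊆T)))
⊆⇒∈subsetsOf {S = inside ∷ S}  {inside ∷ T}  S⊆T =
  ∈-++⁺ʳ (List.map (outside ∷_) (subsetsOf T))
         (∈-map⁺ (inside ∷_) (⊆⇒∈subsetsOf (drop-∷-⊆ S⊆T)))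

does≡⇒⇔ : ∀ {a b} {A : Set a} {B : Set b} (a? : Dec A) (b? : Dec B) → does a? ≡ does b? → A ⇔ B
does≡⇒⇔ (yes a) (yes b) _ = mk⇔ (λ _ → b) (λ _ → a)
does≡⇒⇔ (no ¬a) (no ¬b) _ = mk⇔ (λ a → contradiction a ¬a) (λ b → contradiction b ¬b)

module LinearAlgebra where

  open import Algebra.Bundles using (CommutativeMonoid; CommutativeRing)
  open import Algebra.Properties.CommutativeSemigroup
    (CommutativeMonoid.commutativeSemigroup ℚ.*-1-commutativeMonoid) using (x∙yz≈y∙xz)
  open import Algebra.Properties.Semiring.Sum (CommutativeRing.semiring ℚ.+-*-commutativeRing)
    public using (sum; sum-syntax; sum-cong-≗; ∑-distrib-+; ∑-comm; *-distribˡ-sum; *-distribʳ-sum)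
  open import Data.Rational.Base using (_+_; _*_; -_; _-_; _÷_; _≤_; _<_; NonZero)
  open import Data.Rational.Solver using (module +-*-Solver)
  open +-*-Solver using (solve; _:-_; _:*_; _:=_)

  ΣF≡sum : ∀ {n} (f : Vector ℚ n) → ΣF f ≡ sum f
  ΣF≡sum {zero}  f = refl
  ΣF≡sum {suc n} f = cong (f zero +_) (ΣF≡sum (tail f))

  sum-zero : ∀ {n} (f : Vector ℚ n) → (∀ i → f i ≡ 0ℚ) → sum f ≡ 0ℚ
  sum-zero {zero}  f f≡0 = refl
  sum-zero {suc n} f f≡0 = cong₂ _+_ (f≡0 zero) (sum-zero (tail f) (f≡0 ∘ suc))

  sum-neg : ∀ {n} (f : Vector ℚ n) → ∑[ i < n ] (- f i) ≡ - sum f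
  sum-neg {zero}  f = refl
  sum-neg {suc n} f = trans (cong (- f zero +_) (sum-neg (tail f))) (sym (ℚ.neg-distrib-+ (f zero) _))

  ∑-distrib-sub : ∀ {n} (f g : Vector ℚ n) → ∑[ i < n ] (f i - g i) ≡ sum f - sum g
  ∑-distrib-sub f g = trans (∑-distrib-+ f (-_ ∘ g)) (cong (sum f +_) (sum-neg g))

  sum-nonneg : ∀ {n} (f : Vector ℚ n) → (∀ i → 0ℚ ≤ f i) → 0ℚ ≤ sum f
  sum-nonneg {zero}  f f≥0 = ℚ.≤-refl
  sum-nonneg {suc n} f f≥0 = ℚ.+-mono-≤ (f≥0 zero) (sum-nonneg (tail f) (f≥0 ∘ suc))

  sum-pos : ∀ {n} (f : Vector ℚ n) → (∀ i → 0ℚ ≤ f i) → ∀ j → 0ℚ < f j → 0ℚ < sum f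
  sum-pos f f≥0 zero    fj>0 = ℚ.+-mono-<-≤ fj>0 (sum-nonneg (tail f) (f≥0 ∘ suc))
  sum-pos f f≥0 (suc j) fj>0 = ℚ.+-mono-≤-< (f≥0 zero) (sum-pos (tail f) (f≥0 ∘ suc) j fj>0)

  δ : ∀ {n} → Fin n → Fin n → ℚ
  δ i j = if does (i ≟ j) then 1ℚ else 0ℚ

  δ-diag : ∀ {n} (i : Fin n) → δ i i ≡ 1ℚ
  δ-diag zero    = refl
  δ-diag (suc i) = δ-diag i

  δ-off : ∀ {n} {i j : Fin n} → i ≢ j → δ i j ≡ 0ℚ
  δ-off {i = i} {j} i≢j = cong (if_then 1ℚ else 0ℚ) (dec-false (i ≟ j) i≢j)

  sum-δ : ∀ {n} (i : Fin n) (f : Vector ℚ n) → ∑[ j < n ] (δ i j * f j) ≡ f i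
  sum-δ zero    f = trans (cong₂ _+_ (ℚ.*-identityˡ (f zero)) (sum-zero _ (ℚ.*-zeroˡ ∘ tail f)))
                          (ℚ.+-identityʳ (f zero))
  sum-δ (suc i) f = trans (cong₂ _+_ (ℚ.*-zeroˡ (f zero)) (sum-δ i (tail f)))
                          (ℚ.+-identityˡ (f (suc i)))

  infix 7 _·_
  _·_ : ∀ {n} → Vector ℚ n → Vector ℚ n → ℚ
  _·_ {n} u v = ∑[ i < n ] (u i * v i)

  combination : ∀ {N n} → Vector ℚ N → (Fin N → Vector ℚ n) → Vector ℚ n
  combination {N} a p i = ∑[ y < N ] (a y * p y i)

  ·-combination : ∀ {N n} (ω : Vector ℚ n) (a : Vector ℚ N) (p : Fin N → Vector ℚ n) →
                  ω · combination a p ≡ ∑[ y < N ] (a y * (ω · p y))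
  ·-combination {N} {n} ω a p = begin
    ∑[ i < n ] (ω i * ∑[ y < N ] (a y * p y i))
      ≡⟨ sum-cong-≗ (λ i → *-distribˡ-sum (ω i) (λ y → a y * p y i)) ⟩
    ∑[ i < n ] ∑[ y < N ] (ω i * (a y * p y i))
      ≡⟨ ∑-comm (λ i y → ω i * (a y * p y i)) ⟩
    ∑[ y < N ] ∑[ i < n ] (ω i * (a y * p y i))
      ≡⟨ sum-cong-≗ (λ y → sum-cong-≗ (λ i → x∙yz≈y∙xz (ω i) (a y) (p y i))) ⟩
    ∑[ y < N ] ∑[ i < n ] (a y * (ω i * p y i))
      ≡⟨ sum-cong-≗ (λ y → *-distribˡ-sum (a y) (λ i → ω i * p y i)) ⟨
    ∑[ y < N ] (a y * (ω · p y)) ∎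
    where open ≡-Reasoning

  SupportedOn : ∀ {n} → Subset n → Vector ℚ n → Set
  SupportedOn T v = ∀ {i} → i ∉ T → v i ≡ 0ℚ

  record Dependence {N n} (Y : Subset N) (p : Fin N → Vector ℚ n) : Set where
    field
      coeff           : Vector ℚ N
      coeff-supported : SupportedOn Y coeff
      positiveAt      : Fin N
      coeff-positive  : 0ℚ < coeff positiveAt
      combination≡0   : ∀ i → combination coeff p i ≡ 0ℚ

  coeff-positive⇒∈ : ∀ {N n} {Y : Subset N} {p : Fin N → Vector ℚ n} (D : Dependence Y p) →
                     ∀ {y} → 0ℚ < Dependence.coeff D y → y ∈ Y
  coeff-positive⇒∈ {Y = Y} D {y} coeff>0 = decidable-stable (y ∈? Y)
    (λ y∉Y → ℚ.<-irrefl (sym (Dependence.coeff-supported D y∉Y)) coeff>0)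

  Nonempty⇒Dependence : ∀ {N} {Y : Subset N} → Nonempty Y → (p : Fin N → Vector ℚ 0) → Dependence Y p
  Nonempty⇒Dependence (y , y∈Y) p = record
    { coeff           = δ y
    ; coeff-supported = λ {y′} y′∉Y → δ-off {i = y} {y′} (λ { refl → y′∉Y y∈Y })
    ; positiveAt      = y
    ; coeff-positive  = subst (0ℚ <_) (sym (δ-diag y)) (ℚ.positive⁻¹ 1ℚ)
    ; combination≡0   = λ ()
    }

  module _ {N n : ℕ} {Y : Subset N} where

    Dependence-fromTail : {p : Fin N → Vector ℚ (suc n)} → (∀ {y} → y ∈ Y → p y zero ≡ 0ℚ) →
                          Dependence Y (tail ∘ p) → Dependence Y p
    Dependence-fromTail {p} head≡0 D = record
      { coeff           = coeff
      ; coeff-supported = coeff-supported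
      ; positiveAt      = positiveAt
      ; coeff-positive  = coeff-positive
      ; combination≡0   = λ { zero → sum-zero _ term≡0 ; (suc i) → combination≡0 i }
      }
      where
      open Dependence D
      term≡0 : ∀ y → coeff y * p y zero ≡ 0ℚ
      term≡0 y with y ∈? Y
      ... | yes y∈Y = trans (cong (coeff y *_) (head≡0 y∈Y)) (ℚ.*-zeroʳ (coeff y))
      ... | no  y∉Y = trans (cong (_* p y zero) (coeff-supported y∉Y)) (ℚ.*-zeroˡ (p y zero))

    Dependence-unshear : {p : Fin N → Vector ℚ n} {y₀ : Fin N} → y₀ ∈ Y → (c : Vector ℚ N) →
                         Dependence (Y ∖ y₀) (λ y i → p y i - c y * p y₀ i) → Dependence Y p
    Dependence-unshear {p} {y₀} y₀∈Y c D = record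
      { coeff           = coeff′
      ; coeff-supported = coeff′-supported
      ; positiveAt      = positiveAt
      ; coeff-positive  = subst (0ℚ <_) (sym (coeff′≡coeff y₀≢positiveAt)) coeff-positive
      ; combination≡0   = λ i → trans (combination-coeff′ i)
                                       (trans (sym (combination-sheared i)) (combination≡0 i))
      }
      where
      open Dependence D
      open ≡-Reasoning
      μ : ℚ
      μ = ∑[ y < N ] (coeff y * c y)
      coeff′ : Vector ℚ N
      coeff′ y = coeff y - μ * δ y₀ y

      coeff′≡coeff : ∀ {y} → y₀ ≢ y → coeff′ y ≡ coeff y
      coeff′≡coeff {y} y₀≢y = begin
        coeff y - μ * δ y₀ y  ≡⟨ cong (λ d → coeff y - μ * d) (δ-off y₀≢y) ⟩
        coeff y - μ * 0ℚ      ≡⟨ cong (λ x → coeff y - x) (ℚ.*-zeroʳ μ) ⟩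
        coeff y - 0ℚ          ≡⟨ ℚ.+-identityʳ (coeff y) ⟩
        coeff y               ∎

      coeff′-supported : SupportedOn Y coeff′
      coeff′-supported y∉Y =
        trans (coeff′≡coeff (λ { refl → y∉Y y₀∈Y })) (coeff-supported (y∉Y ∘ p─q⊆p Y _))

      y₀≢positiveAt : y₀ ≢ positiveAt
      y₀≢positiveAt refl = x∉p∖x (coeff-positive⇒∈ D coeff-positive)

      combination-coeff′ : ∀ i → combination coeff′ p i ≡ combination coeff p i - μ * p y₀ i
      combination-coeff′ i = begin
        ∑[ y < N ] ((coeff y - μ * δ y₀ y) * p y i)
          ≡⟨ sum-cong-≗ (λ y → solve 4 (λ a m d x → (a :- m :* d) :* x := a :* x :- m :* (d :* x))
                                      refl (coeff y) μ (δ y₀ y) (p y i)) ⟩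
        ∑[ y < N ] (coeff y * p y i - μ * (δ y₀ y * p y i))
          ≡⟨ ∑-distrib-sub (λ y → coeff y * p y i) (λ y → μ * (δ y₀ y * p y i)) ⟩
        combination coeff p i - ∑[ y < N ] (μ * (δ y₀ y * p y i))
          ≡⟨ cong (λ x → combination coeff p i - x) (*-distribˡ-sum μ (λ y → δ y₀ y * p y i)) ⟨
        combination coeff p i - μ * ∑[ y < N ] (δ y₀ y * p y i)
          ≡⟨ cong (λ x → combination coeff p i - μ * x) (sum-δ y₀ (λ y → p y i)) ⟩
        combination coeff p i - μ * p y₀ i ∎

      combination-sheared : ∀ i → combination coeff (λ y i → p y i - c y * p y₀ i) i ≡
                                  combination coeff p i - μ * p y₀ i
      combination-sheared i = begin
        ∑[ y < N ] (coeff y * (p y i - c y * p y₀ i))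
          ≡⟨ sum-cong-≗ (λ y → solve 4 (λ a x b z → a :* (x :- b :* z) := a :* x :- (a :* b) :* z)
                                      refl (coeff y) (p y i) (c y) (p y₀ i)) ⟩
        ∑[ y < N ] (coeff y * p y i - coeff y * c y * p y₀ i)
          ≡⟨ ∑-distrib-sub (λ y → coeff y * p y i) (λ y → coeff y * c y * p y₀ i) ⟩
        combination coeff p i - ∑[ y < N ] (coeff y * c y * p y₀ i)
          ≡⟨ cong (λ x → combination coeff p i - x) (*-distribʳ-sum (p y₀ i) (λ y → coeff y * c y)) ⟨
        combination coeff p i - μ * p y₀ i ∎

  ÷-*-cancel : ∀ a b .{{_ : NonZero b}} → (a ÷ b) * b ≡ a
  ÷-*-cancel a b = trans (ℚ.*-assoc a (ℚ.1/ b) b) (trans (cong (a *_) (ℚ.*-inverseˡ b)) (ℚ.*-identityʳ a))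

  -- Gaussian elimination on the first coordinate: pivot on it if some vector has it nonzero,
  -- otherwise drop it.
  ∣T∣<∣Y∣⇒Dependence : ∀ {n N} (T : Subset n) {Y : Subset N} (p : Fin N → Vector ℚ n) →
                       (∀ {y} → y ∈ Y → SupportedOn T (p y)) → ∣ T ∣ ℕ.< ∣ Y ∣ → Dependence Y p

  zeroHead⇒Dependence : ∀ {n N} s (T : Subset n) {Y : Subset N} (p : Fin N → Vector ℚ (suc n)) →
                        (∀ {y} → y ∈ Y → SupportedOn (s ∷ T) (p y)) →
                        (∀ {y} → y ∈ Y → p y zero ≡ 0ℚ) → ∣ T ∣ ℕ.< ∣ Y ∣ → Dependence Y p
  zeroHead⇒Dependence s T p supported head≡0 ∣T∣<∣Y∣ = Dependence-fromTail head≡0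
    (∣T∣<∣Y∣⇒Dependence T (tail ∘ p) (λ y∈Y i∉T → supported y∈Y (i∉T ∘ drop-there))
                         ∣T∣<∣Y∣)

  ∣T∣<∣Y∣⇒Dependence []            {Y} p supported 0<∣Y∣ =
    Nonempty⇒Dependence (0<∣p∣⇒Nonempty Y 0<∣Y∣) p
  ∣T∣<∣Y∣⇒Dependence (outside ∷ T) p supported ∣T∣<∣Y∣ =
    zeroHead⇒Dependence outside T p supported (λ y∈Y → supported y∈Y λ ()) ∣T∣<∣Y∣
  ∣T∣<∣Y∣⇒Dependence {suc n} {N} (inside ∷ T) {Y} p supported ∣T∣<∣Y∣
    with any? (λ y → (y ∈? Y) ×-dec ¬? (p y zero ℚ.≟ 0ℚ))
  ... | no noPivot =
    zeroHead⇒Dependence inside T p supported head≡0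
                        (ℕ.≤-<-trans (∣p∣≤∣x∷p∣ inside T) ∣T∣<∣Y∣)
    where
    head≡0 : ∀ {y} → y ∈ Y → p y zero ≡ 0ℚ
    head≡0 {y} y∈Y = decidable-stable (p y zero ℚ.≟ 0ℚ) (λ p≢0 → noPivot (y , y∈Y , p≢0))
  ... | yes (y₀ , y₀∈Y , pivot≢0) =
    Dependence-unshear y₀∈Y c
      (zeroHead⇒Dependence inside T sheared sheared-supported sheared-head ∣T∣<∣Y∖y₀∣)
    where
    instance
      pivot-nonZero : NonZero (p y₀ zero)
      pivot-nonZero = ℚ.≢-nonZero pivot≢0
    c : Vector ℚ N
    c y = p y zero ÷ p y₀ zero
    sheared : Fin N → Vector ℚ (suc n)
    sheared y i = p y i - c y * p y₀ i
    sheared-head : ∀ {y} → y ∈ Y ∖ y₀ → sheared y zero ≡ 0ℚ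
    sheared-head {y} _ = trans (cong (λ x → p y zero - x) (÷-*-cancel (p y zero) (p y₀ zero)))
                               (ℚ.+-inverseʳ (p y zero))
    sheared-supported : ∀ {y} → y ∈ Y ∖ y₀ → SupportedOn (inside ∷ T) (sheared y)
    sheared-supported {y} y∈Y∖y₀ {i} i∉T = begin
      p y i - c y * p y₀ i  ≡⟨ cong₂ (λ x z → x - c y * z) (supported (p─q⊆p Y _ y∈Y∖y₀) i∉T)
                                                          (supported y₀∈Y i∉T) ⟩
      0ℚ - c y * 0ℚ         ≡⟨ cong (λ x → 0ℚ - x) (ℚ.*-zeroʳ (c y)) ⟩
      0ℚ                    ∎
      where open ≡-Reasoning
    ∣T∣<∣Y∖y₀∣ : ∣ T ∣ ℕ.< ∣ Y ∖ y₀ ∣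
    ∣T∣<∣Y∖y₀∣ =
      ℕ.s≤s⁻¹ (subst (suc (suc ∣ T ∣) ℕ.≤_) (sym (x∈p⇒suc∣p∖x∣≡∣p∣ y₀∈Y)) ∣T∣<∣Y∣)

module SauerShelah where

  open import Algebra.Properties.CommutativeSemigroup ℕ.+-commutativeSemigroup
    using () renaming (interchange to +-interchange)
  open import Data.Nat.Base using (_+_; _^_; _*_; _≤_; _<_; z≤n; s≤s; s≤s⁻¹)
  open import Data.Nat.Properties
    using ( ≤-refl; ≤-reflexive; ≤-trans; +-mono-≤; +-identityʳ; +-comm; +-suc; *-monoʳ-≤; ^-monoˡ-≤
          ; m^n>0; n≤1+n; n≮0; module ≤-Reasoning)

  Family : ℕ → Set
  Family N = Subset N → Bool

  infixr 6 _∪ᶠ_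
  infixr 7 _∩ᶠ_
  _∪ᶠ_ _∩ᶠ_ : ∀ {N} → Family N → Family N → Family N
  (F ∪ᶠ G) b = F b ∨ G b
  (F ∩ᶠ G) b = F b ∧ G b

  count : ∀ {N} → Family N → ℕ
  count {zero}  F = if F [] then 1 else 0
  count {suc N} F = count (F ∘ (outside ∷_)) + count (F ∘ (inside ∷_))

  count-cong : ∀ {N} {F G : Family N} → (∀ b → F b ≡ G b) → count F ≡ count G
  count-cong {zero}  F≗G = cong (if_then 1 else 0) (F≗G [])
  count-cong {suc N} F≗G =
    cong₂ _+_ (count-cong (F≗G ∘ (outside ∷_))) (count-cong (F≗G ∘ (inside ∷_)))

  count-empty : ∀ {N} (F : Family N) → (∀ b → ¬ T (F b)) → count F ≡ 0
  count-empty {zero}  F ∉F with F [] | ∉F []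
  ... | true  | ∉F[] = contradiction _ ∉F[]
  ... | false | _    = refl
  count-empty {suc N} F ∉F =
    cong₂ _+_ (count-empty _ (∉F ∘ (outside ∷_))) (count-empty _ (∉F ∘ (inside ∷_)))

  count-∪ᶠ+∩ᶠ : ∀ {N} (F G : Family N) → count F + count G ≡ count (F ∪ᶠ G) + count (F ∩ᶠ G)
  count-∪ᶠ+∩ᶠ {zero} F G with F [] | G []
  ... | true  | true  = refl
  ... | true  | false = refl
  ... | false | true  = refl
  ... | false | false = refl
  count-∪ᶠ+∩ᶠ {suc N} F G = begin
    (c F₀ + c F₁) + (c G₀ + c G₁)
      ≡⟨ +-interchange (c F₀) _ _ _ ⟩
    (c F₀ + c G₀) + (c F₁ + c G₁)
      ≡⟨ cong₂ _+_ (count-∪ᶠ+∩ᶠ F₀ G₀) (count-∪ᶠ+∩ᶠ F₁ G₁) ⟩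
    (c (F₀ ∪ᶠ G₀) + c (F₀ ∩ᶠ G₀)) + (c (F₁ ∪ᶠ G₁) + c (F₁ ∩ᶠ G₁))
      ≡⟨ +-interchange (c (F₀ ∪ᶠ G₀)) _ _ _ ⟩
    (c (F₀ ∪ᶠ G₀) + c (F₁ ∪ᶠ G₁)) + (c (F₀ ∩ᶠ G₀) + c (F₁ ∩ᶠ G₁)) ∎
    where
    open ≡-Reasoning
    c : Family N → ℕ
    c = count
    F₀ F₁ G₀ G₁ : Family N
    F₀ = F ∘ (outside ∷_)
    F₁ = F ∘ (inside ∷_)
    G₀ = G ∘ (outside ∷_)
    G₁ = G ∘ (inside ∷_)

  infix 4 _≟ˢ_
  _≟ˢ_ : ∀ {N} → DecidableEquality (Subset N)
  _≟ˢ_ = ≡-dec Bool._≟_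

  count-remove : ∀ {N} (F : Family N) {v} → T (F v) →
                 count F ≡ suc (count (λ b → F b ∧ not (does (b ≟ˢ v))))
  count-remove {zero}  F {[]} Fv with F []
  ... | true = refl
  count-remove {suc N} F {outside ∷ v} Fv =
    cong₂ _+_ (count-remove (F ∘ (outside ∷_)) Fv)
              (count-cong {N} (λ b → sym (Bool.∧-identityʳ (F (inside ∷ b)))))
  count-remove {suc N} F {inside ∷ v} Fv =
    trans (cong₂ _+_ (count-cong {N} (λ b → sym (Bool.∧-identityʳ (F (outside ∷ b)))))
                     (count-remove (F ∘ (inside ∷_)) Fv))
          (+-suc (count (λ b → F (outside ∷ b) ∧ true)) _)

  injection⇒≤count : ∀ {N m} (F : Family N) (g : Fin m → Subset N) → Injective _≡_ _≡_ g →
                     (∀ i → T (F (g i))) → m ≤ count F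
  injection⇒≤count {m = zero}  F g _         _   = z≤n
  injection⇒≤count {m = suc m} F g injective g∈F = begin
    suc m
      ≤⟨ s≤s (injection⇒≤count F′ (g ∘ suc) (suc-injective ∘ injective) g∘suc∈F′) ⟩
    suc (count F′)
      ≡⟨ count-remove F (g∈F zero) ⟨
    count F ∎
    where
    open ≤-Reasoning
    F′ : Family _
    F′ b = F b ∧ not (does (b ≟ˢ g zero))
    g∘suc∈F′ : ∀ i → T (F′ (g (suc i)))
    g∘suc∈F′ i = from Bool.T-∧ (g∈F (suc i) , from Bool.T-not-≡
      (dec-false (g (suc i) ≟ˢ g zero) (λ eq → 0≢1+n (injective (sym eq)))))

  Image : ∀ {N m} → (Fin m → Subset N) → Family N
  Image g b = isYes (any? (λ i → g i ≟ˢ b))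

  Image-member : ∀ {N m} (g : Fin m → Subset N) i → T (Image g (g i))
  Image-member g i = fromWitness {a? = any? (λ j → g j ≟ˢ g i)} (i , refl)

  Image-sound : ∀ {N m} (g : Fin m → Subset N) {b} → T (Image g b) → ∃ λ i → g i ≡ b
  Image-sound g {b} = toWitness {a? = any? (λ i → g i ≟ˢ b)}

  Shatters : ∀ {N} → Family N → Subset N → Set
  Shatters F Y = ∀ target → ∃ λ b → T (F b) × (∀ {y} → y ∈ Y → lookup b y ≡ lookup target y)

  VCDimension≤ : ∀ {N} → Family N → ℕ → Set
  VCDimension≤ F d = ∀ Y → Shatters F Y → ∣ Y ∣ ≤ d

  member⇒Shatters-⊥ : ∀ {N} {F : Family N} {b} → T (F b) → Shatters F ⊥
  member⇒Shatters-⊥ {b = b} Fb _ = b , Fb , λ y∈⊥ → contradiction y∈⊥ ∉⊥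

  module _ {N : ℕ} (F : Family (suc N)) where

    private
      F₀ F₁ : Family N
      F₀ = F ∘ (outside ∷_)
      F₁ = F ∘ (inside ∷_)

    Shatters-∪ᶠ : ∀ {Y} → Shatters (F₀ ∪ᶠ F₁) Y → Shatters F (outside ∷ Y)
    Shatters-∪ᶠ shatters (_ ∷ target) with shatters target
    ... | b , F₀b∨F₁b , agree with to Bool.T-∨ F₀b∨F₁b
    ...   | inj₁ F₀b = outside ∷ b , F₀b , λ { (there y∈Y) → agree y∈Y }
    ...   | inj₂ F₁b = inside ∷ b , F₁b , λ { (there y∈Y) → agree y∈Y }

    Shatters-∩ᶠ : ∀ {Y} → Shatters (F₀ ∩ᶠ F₁) Y → Shatters F (inside ∷ Y)
    Shatters-∩ᶠ shatters (s ∷ target) with shatters target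
    ... | b , F₀b∧F₁b , agree = s ∷ b , member s , λ { here → refl ; (there y∈Y) → agree y∈Y }
      where
      member : ∀ s → T (F (s ∷ b))
      member outside = proj₁ (to Bool.T-∧ F₀b∧F₁b)
      member inside  = proj₂ (to Bool.T-∧ F₀b∧F₁b)

  -- Φ N d = ∑_{i < d} (N choose i).
  Φ : ℕ → ℕ → ℕ
  Φ _       zero    = 0
  Φ zero    (suc d) = 1
  Φ (suc N) (suc d) = Φ N (suc d) + Φ N d

  sauer-shelah : ∀ {N} d (F : Family N) → (∀ Y → Shatters F Y → ∣ Y ∣ < d) → count F ≤ Φ N d
  sauer-shelah zero F small = ≤-reflexive (count-empty F λ _ Fb → n≮0 (small ⊥ (member⇒Shatters-⊥ Fb)))
  sauer-shelah {zero} (suc d) F _ with F []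
  ... | true  = ≤-refl
  ... | false = z≤n
  sauer-shelah {suc N} (suc d) F small = begin
    count F                              ≡⟨ count-∪ᶠ+∩ᶠ F₀ F₁ ⟩
    count (F₀ ∪ᶠ F₁) + count (F₀ ∩ᶠ F₁)  ≤⟨ +-mono-≤ (sauer-shelah (suc d) _ small-∪ᶠ)
                                                     (sauer-shelah d _ small-∩ᶠ) ⟩
    Φ N (suc d) + Φ N d                  ∎
    where
    open ≤-Reasoning
    F₀ F₁ : Family N
    F₀ = F ∘ (outside ∷_)
    F₁ = F ∘ (inside ∷_)
    small-∪ᶠ : ∀ Y → Shatters (F₀ ∪ᶠ F₁) Y → ∣ Y ∣ < suc d
    small-∪ᶠ Y shatters = small (outside ∷ Y) (Shatters-∪ᶠ F shatters)
    small-∩ᶠ : ∀ Y → Shatters (F₀ ∩ᶠ F₁) Y → ∣ Y ∣ < d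
    small-∩ᶠ Y shatters = s≤s⁻¹ (small (inside ∷ Y) (Shatters-∩ᶠ F shatters))

  Φ-bound : ∀ N d → Φ N (suc d) ≤ suc N ^ d
  Φ-bound zero    d       = m^n>0 1 d
  Φ-bound (suc N) zero    = ≤-trans (≤-reflexive (+-identityʳ _)) (Φ-bound N zero)
  Φ-bound (suc N) (suc d) = begin
    Φ N (suc (suc d)) + Φ N (suc d)  ≤⟨ +-mono-≤ (Φ-bound N (suc d)) (Φ-bound N d) ⟩
    suc N * x + x                    ≡⟨ +-comm (suc N * x) x ⟩
    suc (suc N) * x                  ≤⟨ *-monoʳ-≤ (suc (suc N)) (^-monoˡ-≤ d (n≤1+n (suc N))) ⟩
    suc (suc N) ^ suc d              ∎
    where
    open ≤-Reasoning
    x : ℕ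
    x = suc N ^ d

  VCDimension≤⇒count≤ : ∀ {N} d (F : Family N) → VCDimension≤ F d → count F ≤ suc N ^ d
  VCDimension≤⇒count≤ {N} d F vc = ≤-trans (sauer-shelah (suc d) F (λ Y → s≤s ∘ vc Y)) (Φ-bound N d)

module SignPatterns where

  open LinearAlgebra
  open SauerShelah
  open import Data.Rational.Base using (_*_; _≤_; _<_)
  open import Data.Rational.Properties using (_<?_)

  *-pos : ∀ {x y} → 0ℚ < x → 0ℚ < y → 0ℚ < x * y
  *-pos {x} {y} x>0 y>0 =
    ℚ.positive⁻¹ (x * y) {{ℚ.pos*pos⇒pos x {{ℚ.positive x>0}} y {{ℚ.positive y>0}}}}

  *-nonpos : ∀ {x y} → x ≤ 0ℚ → y ≤ 0ℚ → 0ℚ ≤ x * y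
  *-nonpos {x} {y} x≤0 y≤0 =
    ℚ.nonNegative⁻¹ (x * y)
      {{ℚ.nonPos*nonPos⇒nonPos x {{ℚ.nonPositive x≤0}} y {{ℚ.nonPositive y≤0}}}}

  same-sign⇒*-nonneg : ∀ {x y} → (0ℚ < x ⇔ 0ℚ < y) → 0ℚ ≤ x * y
  same-sign⇒*-nonneg {x} x>0⇔y>0 with 0ℚ <? x
  ... | yes x>0 = ℚ.<⇒≤ (*-pos x>0 (to x>0⇔y>0 x>0))
  ... | no  x≯0 = *-nonpos (ℚ.≮⇒≥ x≯0) (ℚ.≮⇒≥ (x≯0 ∘ from x>0⇔y>0))

  module _ {N n : ℕ} (p : Fin N → Vector ℚ n) where

    signPattern : Vector ℚ n → Subset N
    signPattern ω = tabulate (λ y → does (0ℚ <? ω · p y))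

    signPattern≡⇒sameSign : ∀ ω ω′ → signPattern ω ≡ signPattern ω′ →
                            ∀ y → 0ℚ < ω · p y ⇔ 0ℚ < ω′ · p y
    signPattern≡⇒sameSign ω ω′ eq y = does≡⇒⇔ (0ℚ <? ω · p y) (0ℚ <? ω′ · p y)
      (trans (sym (lookup∘tabulate _ y)) (trans (cong (λ b → lookup b y) eq) (lookup∘tabulate _ y)))

    -- A signPattern ω that realises the signs of the coefficients makes every term of
    -- ∑ coeff y * (ω · p y) = ω · 0 nonnegative and one of them positive.
    Dependence⇒¬Shatters : ∀ {Y} (F : Family N) → (∀ {b} → T (F b) → ∃ λ ω → signPattern ω ≡ b) →
                           Dependence Y p → ¬ Shatters F Y
    Dependence⇒¬Shatters {Y} F F⊆signPatterns D shatters
      with shatters (tabulate (λ y → does (0ℚ <? Dependence.coeff D y)))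
    ... | b , b∈F , agree with F⊆signPatterns b∈F
    ...   | ω , refl = ℚ.<-irrefl (sym ∑terms≡0) (sum-pos term term≥0 positiveAt term>0)
      where
      open Dependence D
      term : Vector ℚ N
      term y = coeff y * (ω · p y)

      sameSign : ∀ {y} → y ∈ Y → 0ℚ < coeff y ⇔ 0ℚ < ω · p y
      sameSign {y} y∈Y = does≡⇒⇔ (0ℚ <? coeff y) (0ℚ <? ω · p y)
        (trans (sym (lookup∘tabulate _ y)) (trans (sym (agree y∈Y)) (lookup∘tabulate _ y)))

      term≥0 : ∀ y → 0ℚ ≤ term y
      term≥0 y with y ∈? Y
      ... | yes y∈Y = same-sign⇒*-nonneg (sameSign y∈Y)
      ... | no  y∉Y =
        ℚ.≤-reflexive (sym (trans (cong (_* (ω · p y)) (coeff-supported y∉Y)) (ℚ.*-zeroˡ (ω · p y))))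

      term>0 : 0ℚ < term positiveAt
      term>0 = *-pos coeff-positive (to (sameSign (coeff-positive⇒∈ D coeff-positive)) coeff-positive)

      ∑terms≡0 : sum term ≡ 0ℚ
      ∑terms≡0 = trans (sym (·-combination ω coeff p))
                       (sum-zero _ (λ i → trans (cong (ω i *_) (combination≡0 i)) (ℚ.*-zeroʳ (ω i))))

    signPatterns-VCDimension≤ : (U : Subset n) → (∀ y → SupportedOn U (p y)) →
                                (F : Family N) → (∀ {b} → T (F b) → ∃ λ ω → signPattern ω ≡ b) →
                                VCDimension≤ F ∣ U ∣
    signPatterns-VCDimension≤ U supported F F⊆signPatterns Y shatters = ℕ.≮⇒≥ λ ∣U∣<∣Y∣ →
      Dependence⇒¬Shatters F F⊆signPatterns
        (∣T∣<∣Y∣⇒Dependence U p (λ {y} _ → supported y) ∣U∣<∣Y∣) shatters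

    distinctSignPatterns≤ : (U : Subset n) → (∀ y → SupportedOn U (p y)) →
                            ∀ {m} (ω : Fin m → Vector ℚ n) → Injective _≡_ _≡_ (signPattern ∘ ω) →
                            m ℕ.≤ suc N ℕ.^ ∣ U ∣
    distinctSignPatterns≤ U supported {m} ω injective = ℕ.≤-trans
      (injection⇒≤count (Image g) g injective (Image-member g))
      (VCDimension≤⇒count≤ ∣ U ∣ (Image g) (signPatterns-VCDimension≤ U supported (Image g) image⊆signPatterns))
      where
      g : Fin m → Subset N
      g = signPattern ∘ ω
      image⊆signPatterns : ∀ {b} → T (Image g b) → ∃ λ ω′ → signPattern ω′ ≡ b
      image⊆signPatterns b∈image with Image-sound g b∈image
      ... | i , gi≡b = ω i , gi≡b

module MinimumCuts where

  open LinearAlgebra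
  open SignPatterns using (signPattern; signPattern≡⇒sameSign)
  open import Data.Rational.Base using (_+_; _*_; -_; _-_; _≤_; _<_)
  open import Data.Rational.Properties using (_<?_)
  open import Data.Rational.Solver using (module +-*-Solver)
  open +-*-Solver using (solve; con; _:+_; _:*_; _:-_; :-_; _:=_)

  0+1*a≡a+0*x : ∀ a x → 0ℚ + 1ℚ * a ≡ a + 0ℚ * x
  0+1*a≡a+0*x = solve 2 (λ a x → con 0ℚ :+ con 1ℚ :* a := a :+ con 0ℚ :* x) refl

  side : ∀ {n} → Subset n → Vector ℚ n
  side A u = if lookup A u then 1ℚ else - 1ℚ

  0<side⇔∈ : ∀ {n} (A : Subset n) u → 0ℚ < side A u ⇔ u ∈ A
  0<side⇔∈ A u with lookup A u in eq
  ... | inside  = mk⇔ (λ _ → lookup⇒[]= u A eq) (λ _ → ℚ.positive⁻¹ 1ℚ)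
  ... | outside = mk⇔ (λ 0<-1 → contradiction 0<-1 (ℚ.<-asym (ℚ.negative⁻¹ (- 1ℚ))))
                      (λ u∈A → contradiction (trans (sym ([]=⇒lookup u∈A)) eq) λ ())

  module _ {n : ℕ} (G : WGraph n) where

    cutTerm : Subset n → Fin n → Fin n → ℚ
    cutTerm A u u′ = if lookup A u ∧ not (lookup A u′) then w G u u′ else 0ℚ

    inWeight outWeight : Subset n → Fin n → Vector ℚ n
    inWeight  A v u = if lookup A u then w G v u else 0ℚ
    outWeight A v u = if lookup A u then 0ℚ else w G v u

    attachment : Subset n → Fin n → ℚ
    attachment A v = ∑[ u < n ] (w G v u * side A u)

    cutWeight≡∑∑cutTerm : ∀ A → cutWeight G A ≡ ∑[ u < n ] ∑[ u′ < n ] cutTerm A u u′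
    cutWeight≡∑∑cutTerm A =
      trans (ΣF≡sum (λ u → ΣF (cutTerm A u))) (sum-cong-≗ (λ u → ΣF≡sum (cutTerm A u)))

    attachment≡in-out : ∀ A v → attachment A v ≡ sum (inWeight A v) - sum (outWeight A v)
    attachment≡in-out A v = trans (sum-cong-≗ pointwise) (∑-distrib-sub (inWeight A v) (outWeight A v))
      where
      pointwise : ∀ u → w G v u * side A u ≡ inWeight A v u - outWeight A v u
      pointwise u with lookup A u
      ... | inside  = solve 1 (λ x → x :* con 1ℚ := x :- con 0ℚ) refl (w G v u)
      ... | outside = solve 1 (λ x → x :* (:- con 1ℚ) := con 0ℚ :- x) refl (w G v u)

    -- The δ-terms are the row and the column of v, the only entries that moving v changes.
    cutTerm-moveOut : ∀ A v u u′ → cutTerm (A [ v ]≔ outside) u u′ + δ v u * outWeight A v u′ ≡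
                                   cutTerm (A [ v ]≔ inside) u u′ + δ v u′ * inWeight A v u
    cutTerm-moveOut A v u u′ with u ≟ v | u′ ≟ v
    ... | yes refl | yes refl
      rewrite lookup∘update u A outside | lookup∘update u A inside | δ-diag u | w-noloop G u = refl
    ... | yes refl | no u′≢u
      rewrite lookup∘update′ u′≢u A outside | lookup∘update′ u′≢u A inside
            | lookup∘update u A outside | lookup∘update u A inside | δ-diag u | δ-off (u′≢u ∘ sym)
      with lookup A u′
    ...   | inside  = 0+1*a≡a+0*x 0ℚ (inWeight A u u)
    ...   | outside = 0+1*a≡a+0*x (w G u u′) (inWeight A u u)
    cutTerm-moveOut A v u u′ | no u≢v | yes refl
      rewrite lookup∘update′ u≢v A outside | lookup∘update′ u≢v A inside
            | lookup∘update u′ A outside | lookup∘update u′ A inside | δ-diag u′ | δ-off (u≢v ∘ sym)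
      with lookup A u
    ...   | inside  = trans (cong (_+ 0ℚ * outWeight A u′ u′) (w-sym G u u′))
                            (sym (0+1*a≡a+0*x (w G u′ u) (outWeight A u′ u′)))
    ...   | outside = sym (0+1*a≡a+0*x 0ℚ (outWeight A u′ u′))
    cutTerm-moveOut A v u u′ | no u≢v | no u′≢v
      rewrite δ-off (u≢v ∘ sym) | δ-off (u′≢v ∘ sym)
            | lookup∘update′ u≢v A outside | lookup∘update′ u≢v A inside
            | lookup∘update′ u′≢v A outside | lookup∘update′ u′≢v A inside =
      cong (cutTerm A u u′ +_) (trans (ℚ.*-zeroˡ (outWeight A v u′)) (sym (ℚ.*-zeroˡ (inWeight A v u))))

    cutWeight-moveOut : ∀ A v →
                        cutWeight G (A [ v ]≔ outside) ≡ cutWeight G (A [ v ]≔ inside) + attachment A v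
    cutWeight-moveOut A v = begin
      cut⁻                  ≡⟨ solve 2 (λ a o → a := (a :+ o) :- o) refl cut⁻ ∑out ⟩
      (cut⁻ + ∑out) - ∑out  ≡⟨ cong (_- ∑out) balance ⟩
      (cut⁺ + ∑in) - ∑out   ≡⟨ solve 3 (λ b i o → (b :+ i) :- o := b :+ (i :- o)) refl cut⁺ ∑in ∑out ⟩
      cut⁺ + (∑in - ∑out)   ≡⟨ cong (cut⁺ +_) (attachment≡in-out A v) ⟨
      cut⁺ + attachment A v ∎
      where
      open ≡-Reasoning
      cut⁻ cut⁺ ∑in ∑out : ℚ
      cut⁻ = cutWeight G (A [ v ]≔ outside)
      cut⁺ = cutWeight G (A [ v ]≔ inside)
      ∑in  = sum (inWeight A v)
      ∑out = sum (outWeight A v)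

      ∑∑-distrib-+ : (f g : Fin n → Fin n → ℚ) → ∑[ u < n ] ∑[ u′ < n ] (f u u′ + g u u′) ≡
                     ∑[ u < n ] ∑[ u′ < n ] f u u′ + ∑[ u < n ] ∑[ u′ < n ] g u u′
      ∑∑-distrib-+ f g =
        trans (sum-cong-≗ (λ u → ∑-distrib-+ (f u) (g u))) (∑-distrib-+ (sum ∘ f) (sum ∘ g))

      balance : cut⁻ + ∑out ≡ cut⁺ + ∑in
      balance = begin
        cut⁻ + ∑out
          ≡⟨ cong₂ _+_ (cutWeight≡∑∑cutTerm (A [ v ]≔ outside))
                       (sym (trans (sum-cong-≗ (λ u → sym (*-distribˡ-sum (δ v u) (outWeight A v))))
                                   (sum-δ v (λ _ → ∑out)))) ⟩
        ∑[ u < n ] ∑[ u′ < n ] cutTerm (A [ v ]≔ outside) u u′ +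
        ∑[ u < n ] ∑[ u′ < n ] (δ v u * outWeight A v u′)
          ≡⟨ ∑∑-distrib-+ _ _ ⟨
        ∑[ u < n ] ∑[ u′ < n ] (cutTerm (A [ v ]≔ outside) u u′ + δ v u * outWeight A v u′)
          ≡⟨ sum-cong-≗ (λ u → sum-cong-≗ (cutTerm-moveOut A v u)) ⟩
        ∑[ u < n ] ∑[ u′ < n ] (cutTerm (A [ v ]≔ inside) u u′ + δ v u′ * inWeight A v u)
          ≡⟨ ∑∑-distrib-+ _ _ ⟩
        ∑[ u < n ] ∑[ u′ < n ] cutTerm (A [ v ]≔ inside) u u′ +
        ∑[ u < n ] ∑[ u′ < n ] (δ v u′ * inWeight A v u)
          ≡⟨ cong₂ _+_ (sym (cutWeight≡∑∑cutTerm (A [ v ]≔ inside)))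
                       (sum-cong-≗ (λ u → sum-δ v (λ _ → inWeight A v u))) ⟩
        cut⁺ + ∑in ∎

  terminalPoint : ∀ {n} → Subset n → Subset n → Vector ℚ n
  terminalPoint T S u = if lookup T u then side S u else 0ℚ

  terminalPoint-supported : ∀ {n} (T S : Subset n) → SupportedOn T (terminalPoint T S)
  terminalPoint-supported T S u∉T = cong (if_then side S _ else 0ℚ) (lookup-∉ u∉T)

  module _ {n : ℕ} {T S A : Subset n} (separates : Separates T S A) where

    Separates⇒lookup≡ : ∀ {u} → u ∈ T → lookup A u ≡ lookup S u
    Separates⇒lookup≡ {u} u∈T with u ∈? S
    ... | yes u∈S = trans ([]=⇒lookup (proj₁ separates u∈S)) (sym ([]=⇒lookup u∈S))
    ... | no  u∉S =
      trans (lookup-∉ (proj₂ separates (x∈p∧x∉q⇒x∈p─q u∈T u∉S))) (sym (lookup-∉ u∉S))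

    terminalPoint≡side : ∀ {u} → u ∈ T → terminalPoint T S u ≡ side A u
    terminalPoint≡side {u} u∈T = trans (cong (if_then side S u else 0ℚ) ([]=⇒lookup u∈T))
                                       (cong (if_then 1ℚ else - 1ℚ) (sym (Separates⇒lookup≡ u∈T)))

    Separates-update : S ⊆ T → ∀ {v} → v ∉ T → ∀ s → Separates T S (A [ v ]≔ s)
    Separates-update S⊆T v∉T s =
      (λ x∈S → ∈-update⁺ (≢v (S⊆T x∈S)) (proj₁ separates x∈S)) ,
      (λ x∈T─S x∈A′ → proj₂ separates x∈T─S (∈-update⁻ (≢v (p─q⊆p _ _ x∈T─S)) x∈A′))
      where
      ≢v : ∀ {x} → x ∈ T → x ≢ _
      ≢v x∈T refl = v∉T x∈T

  module _ {n : ℕ} (G : WGraph n) (T : Subset n) where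

    vertexVector : Fin n → Vector ℚ n
    vertexVector v = if lookup T v then δ v else w G v

    terminal-vertexVector· : ∀ {v} → v ∈ T → ∀ x → vertexVector v · x ≡ x v
    terminal-vertexVector· {v} v∈T x =
      trans (cong (λ b → ∑[ u < n ] ((if b then δ v else w G v) u * x u)) ([]=⇒lookup v∈T)) (sum-δ v x)

    nonterminal-weight≡0 : QuasiBipartite G T → ∀ {v u} → v ∉ T → u ∉ T → w G v u ≡ 0ℚ
    nonterminal-weight≡0 qb {v} {u} v∉T u∉T =
      ℚ.≤-antisym (ℚ.≮⇒≥ (λ edge → [ v∉T , u∉T ]′ (qb v u edge))) (w-nonneg G v u)

    nonterminal-vertexVector·terminalPoint : QuasiBipartite G T → ∀ {S A} → Separates T S A →
      ∀ {v} → v ∉ T → vertexVector v · terminalPoint T S ≡ attachment G A v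
    nonterminal-vertexVector·terminalPoint qb {S} {A} separates {v} v∉T =
      trans (cong (λ b → ∑[ u < n ] ((if b then δ v else w G v) u * terminalPoint T S u)) (lookup-∉ v∉T))
            (sum-cong-≗ pointwise)
      where
      pointwise : ∀ u → w G v u * terminalPoint T S u ≡ w G v u * side A u
      pointwise u with u ∈? T
      ... | yes u∈T = cong (w G v u *_) (terminalPoint≡side separates u∈T)
      ... | no  u∉T = trans (cong (_* terminalPoint T S u) w≡0)
                            (trans (ℚ.*-zeroˡ (terminalPoint T S u))
                                   (sym (trans (cong (_* side A u) w≡0) (ℚ.*-zeroˡ (side A u)))))
        where
        w≡0 : w G v u ≡ 0ℚ
        w≡0 = nonterminal-weight≡0 qb v∉T u∉T

    module _ (unique : UniqueMinCuts G T) {S : Subset n} (proper : ProperTermSubset T S)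
             {A : Subset n} (minimum : IsMinCut G T S A) where

      cheaper⇒≡ : ∀ {B} → Separates T S B → cutWeight G B ≤ cutWeight G A → B ≡ A
      cheaper⇒≡ {B} separatesB B≤A = trans (isUnique B minimumB) (sym (isUnique A minimum))
        where
        isUnique : ∀ B → IsMinCut G T S B → B ≡ proj₁ (unique S proper)
        isUnique = proj₂ (proj₂ (unique S proper))
        minimumB : IsMinCut G T S B
        minimumB = separatesB , λ C separatesC → ℚ.≤-trans B≤A (proj₂ minimum C separatesC)

      nonterminal-side : ∀ {v} → v ∉ T → v ∈ A ⇔ 0ℚ < attachment G A v
      nonterminal-side {v} v∉T = mk⇔ attached detached
        where
        open ℚ.≤-Reasoning
        moved : ∀ s → Separates T S (A [ v ]≔ s)
        moved = Separates-update (proj₁ minimum) (proj₁ (proj₂ proper)) v∉T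
        unmoved : ∀ {s} → lookup A v ≡ s → A [ v ]≔ s ≡ A
        unmoved eq = trans (cong (A [ v ]≔_) (sym eq)) ([]≔-lookup A v)

        attached : v ∈ A → 0ℚ < attachment G A v
        attached v∈A = decidable-stable (0ℚ <? attachment G A v) λ att≯0 →
          contradiction (trans (sym (lookup∘update v A outside))
                               (trans (cong (λ B → lookup B v) (cheaper⇒≡ (moved outside) (cheaper att≯0)))
                                      ([]=⇒lookup v∈A)))
                        λ ()
          where
          cheaper : ¬ 0ℚ < attachment G A v → cutWeight G (A [ v ]≔ outside) ≤ cutWeight G A
          cheaper att≯0 = begin
            cutWeight G (A [ v ]≔ outside)
              ≡⟨ cutWeight-moveOut G A v ⟩
            cutWeight G (A [ v ]≔ inside) + attachment G A v
              ≡⟨ cong (λ B → cutWeight G B + attachment G A v) (unmoved ([]=⇒lookup v∈A)) ⟩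
            cutWeight G A + attachment G A v
              ≤⟨ ℚ.+-monoʳ-≤ (cutWeight G A) (ℚ.≮⇒≥ att≯0) ⟩
            cutWeight G A + 0ℚ
              ≡⟨ ℚ.+-identityʳ _ ⟩
            cutWeight G A ∎

        detached : 0ℚ < attachment G A v → v ∈ A
        detached att>0 = decidable-stable (v ∈? A) λ v∉A →
          v∉A (subst (v ∈_) (cheaper⇒≡ (moved inside) (cheaper v∉A))
                             (lookup⇒[]= v _ (lookup∘update v A inside)))
          where
          cheaper : v ∉ A → cutWeight G (A [ v ]≔ inside) ≤ cutWeight G A
          cheaper v∉A = begin
            cutWeight G (A [ v ]≔ inside)
              ≡⟨ ℚ.+-identityʳ _ ⟨
            cutWeight G (A [ v ]≔ inside) + 0ℚ
              ≤⟨ ℚ.+-monoʳ-≤ (cutWeight G (A [ v ]≔ inside)) (ℚ.<⇒≤ att>0) ⟩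
            cutWeight G (A [ v ]≔ inside) + attachment G A v
              ≡⟨ cutWeight-moveOut G A v ⟨
            cutWeight G (A [ v ]≔ outside)
              ≡⟨ cong (cutWeight G) (unmoved (lookup-∉ v∉A)) ⟩
            cutWeight G A ∎

      mincut-side : QuasiBipartite G T → ∀ v → v ∈ A ⇔ 0ℚ < vertexVector v · terminalPoint T S
      mincut-side qb v with v ∈? T
      ... | yes v∈T = subst (λ x → v ∈ A ⇔ 0ℚ < x)
                            (sym (trans (terminal-vertexVector· v∈T _) (terminalPoint≡side (proj₁ minimum) v∈T)))
                            (⇔-sym (0<side⇔∈ A v))
      ... | no  v∉T = subst (λ x → v ∈ A ⇔ 0ℚ < x)
                            (sym (nonterminal-vertexVector·terminalPoint qb (proj₁ minimum) v∉T))
                            (nonterminal-side v∉T)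

  subsetPoints : ∀ {n} (T : Subset n) → Fin (List.length (subsetsOf T)) → Vector ℚ n
  subsetPoints T = terminalPoint T ∘ List.lookup (subsetsOf T)

  subsetPoints-supported : ∀ {n} (T : Subset n) y → SupportedOn T (subsetPoints T y)
  subsetPoints-supported T y = terminalPoint-supported T (List.lookup (subsetsOf T) y)

  module _ {n : ℕ} (G : WGraph n) (T : Subset n) (qb : QuasiBipartite G T) (unique : UniqueMinCuts G T) where

    sameSignPattern⇒SameProfile : ∀ {u v} →
      signPattern (subsetPoints T) (vertexVector G T u) ≡ signPattern (subsetPoints T) (vertexVector G T v) →
      SameProfile G T u v
    sameSignPattern⇒SameProfile {u} {v} samePattern S proper A minimum =
      ⇔-sym (onSide v) ⇔-∘ (sameSign ⇔-∘ onSide u)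
      where
      onSide : ∀ x → x ∈ A ⇔ 0ℚ < vertexVector G T x · terminalPoint T S
      onSide = mincut-side G T unique proper minimum qb
      S∈subsetsOf : S ∈ˡ subsetsOf T
      S∈subsetsOf = ⊆⇒∈subsetsOf (proj₁ (proj₂ proper))
      SameSignAt : Subset n → Set
      SameSignAt S′ = 0ℚ < vertexVector G T u · terminalPoint T S′ ⇔ 0ℚ < vertexVector G T v · terminalPoint T S′
      sameSign : SameSignAt S
      sameSign = subst SameSignAt (sym (lookup-index S∈subsetsOf))
                       (signPattern≡⇒sameSign (subsetPoints T) (vertexVector G T u) (vertexVector G T v)
                                              samePattern (index S∈subsetsOf))

    distinctProfiles⇒Injective : ∀ {m} (f : Fin m → Fin n) →
                                 (∀ i j → ¬ i ≡ j → ¬ SameProfile G T (f i) (f j)) →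
                                 Injective _≡_ _≡_ (signPattern (subsetPoints T) ∘ vertexVector G T ∘ f)
    distinctProfiles⇒Injective f distinct {i} {j} samePattern =
      decidable-stable (i ≟ j) λ i≢j → distinct i j i≢j (sameSignPattern⇒SameProfile samePattern)

open SignPatterns using (distinctSignPatterns≤)
open MinimumCuts using (vertexVector; subsetPoints; subsetPoints-supported; distinctProfiles⇒Injective)
open import Data.Nat using (ℕ; _≤_; _*_; _^_)
open import Data.Nat.Properties
  using (^-monoˡ-≤; ^-monoʳ-≤; ^-*-assoc; +-monoˡ-≤; +-identityʳ; m^n>0; n≤1+n; ≤-trans; module ≤-Reasoning)

[1+2^k]^k≤k^[2kk] : ∀ k → 2 ≤ k → suc (2 ^ k) ^ k ≤ k ^ (2 * k * k)
[1+2^k]^k≤k^[2kk] k 2≤k = begin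
  suc (2 ^ k) ^ k    ≤⟨ ^-monoˡ-≤ k 1+2^k≤2^[2k] ⟩
  (2 ^ (2 * k)) ^ k  ≡⟨ ^-*-assoc 2 (2 * k) k ⟩
  2 ^ (2 * k * k)    ≤⟨ ^-monoˡ-≤ (2 * k * k) 2≤k ⟩
  k ^ (2 * k * k)    ∎
  where
  open ≤-Reasoning
  1+2^k≤2^[2k] : suc (2 ^ k) ≤ 2 ^ (2 * k)
  1+2^k≤2^[2k] = begin
    suc (2 ^ k)          ≤⟨ +-monoˡ-≤ (2 ^ k) (m^n>0 2 k) ⟩
    2 ^ k ℕ.+ 2 ^ k      ≡⟨ cong (2 ^ k ℕ.+_) (+-identityʳ (2 ^ k)) ⟨
    2 ^ suc k            ≤⟨ ^-monoʳ-≤ 2 (+-monoˡ-≤ k (≤-trans (n≤1+n 1) 2≤k)) ⟩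
    2 ^ (k ℕ.+ k)        ≡⟨ cong (λ x → 2 ^ (k ℕ.+ x)) (+-identityʳ k) ⟨
    2 ^ (2 * k)          ∎

lemma4p2 : ∃[ c ] ∃[ k₀ ] (∀ {n : ℕ} (G : WGraph n) (T : Subset n) → QuasiBipartite G T → UniqueMinCuts G T → k₀ ≤ ∣ T ∣ → ProfileCountAtMost G T (∣ T ∣ ^ (c * ∣ T ∣ * ∣ T ∣)))
lemma4p2 = 2 , 2 , λ G T qb unique 2≤∣T∣ m f distinct → begin
  m                                      ≤⟨ distinctSignPatterns≤ (subsetPoints T) T (subsetPoints-supported T)
                                              (vertexVector G T ∘ f) (distinctProfiles⇒Injective G T qb unique f distinct) ⟩
  suc (List.length (subsetsOf T)) ^ ∣ T ∣  ≡⟨ cong (λ N → suc N ^ ∣ T ∣) (length-subsetsOf T) ⟩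
  suc (2 ^ ∣ T ∣) ^ ∣ T ∣                ≤⟨ [1+2^k]^k≤k^[2kk] ∣ T ∣ 2≤∣T∣ ⟩
  ∣ T ∣ ^ (2 * ∣ T ∣ * ∣ T ∣)            ∎
  where open ≤-Reasoning
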